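{- Let $\mathbb{F}$ be a field of characteristic $2$, let $X \subseteq V$ be finite sets, and let $B$ be an $X \times V$-matrix over $\mathbb{F}$ such that $B[X]$ is the identity matrix, i.e., $B = \begin{pmatrix} I & S \end{pmatrix}$ with columns indexed by $X$ and $V\setminus X$ respectively. Let $\alpha$ be an involutive automorphism of $\mathbb{F}$ and let $A = R(B,\alpha)$ be the $V \times V$-matrix $$ A = \begin{pmatrix} 0 & S \\ \alpha(-S^T) & 0 \end{pmatrix} $$ (rows and columns indexed by $X$ then $V\setminus X$). Then for all $Y \subseteq V$, the null space of the $\alpha$-symmetric matrix $A+(X \cup Y)*(X\setminus Y)$ is equal to $\{v \in \ker(B) \mid \pi_Y(v) \in \alpha(\ker(B)^{\perp})\}$.
   Context: Here $\alpha$ is applied entrywise to vectors, matrices and subspaces. A $V\times V$-matrix $A$ is $\alpha$-symmetric if $\alpha(-A^T) = A$. For $Z \subseteq V$, $A+Z$ is the matrix obtained from $A$ by adding $1$ to each diagonal entry indexed by an element of $Z$. For $Z\subseteq V$ with $A[Z]$ nonsingular, $A*Z$ is the principal pivot transform: if $A = \begin{pmatrix} P & Q \\ R & S'\end{pmatrix}$ with respect to the partition $(Z, V\setminus Z)$, then $A*Z = \begin{pmatrix} P^{ -1} & -P^{ -1}Q \\ RP^{ -1} & S' - RP^{ -1}Q\end{pmatrix}$. Operations are applied left to right, so $A+(X\cup Y)*(X\setminus Y)$ means $(A+(X\cup Y))*(X\setminus Y)$. For a vector $v$ over $V$, $\pi_Y(v)$ is obtained from $v$ by setting all entries in $V\setminus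 Y$ to $0$. For a subspace $L \subseteq \mathbb{F}^V$, $L^\perp = \{v \mid \sum_{x\in V} u(x)v(x) = 0 \text{ for all } u \in L\}$. -}

module Defs where

open import Level using (Level; _⊔_) renaming (suc to lsuc)
open import Data.Nat using (ℕ)
open import Data.Fin using (Fin) renaming (_≟_ to _≟ᶠ_)
open import Data.Bool using (Bool; true; false; if_then_else_)
open import Data.Vec using (lookup)
open import Data.Fin.Subset using (Subset; _∈_; _∉_; _∪_; _─_)
open import Data.Product using (Σ; _×_; _,_)
open import Relation.Nullary using (¬_; does)
open import Algebra.Bundles using (CommutativeRing)
open import Algebra.Morphism.Structures using (IsRingHomomorphism)

record Field c ℓ : Set (lsuc (c ⊔ ℓ)) where
  field
    commutativeRing : CommutativeRing c ℓ
  open CommutativeRing commutativeRing public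
  field
    1≉0     : ¬ (1# ≈ 0#)
    inverse : ∀ x → ¬ (x ≈ 0#) → Σ Carrier λ y → (x * y) ≈ 1#

module _ {c ℓ : Level} (F : Field c ℓ) where
  open Field F using (Carrier; _≈_; _+_; _*_; -_; _-_; 0#; 1#; rawRing)

  Char2 : Set ℓ
  Char2 = (1# + 1#) ≈ 0#

  -- α is an involutive automorphism of F
  -- (a ring endomorphism with α ∘ α = id; bijectivity follows)
  record InvolutiveAutomorphism (α : Carrier → Carrier) : Set (c ⊔ ℓ) where
    field
      isRingHom : IsRingHomomorphism rawRing rawRing α
      involutive : ∀ x → α (α x) ≈ x

  Σ[_] : ∀ {n} → (Fin n → Carrier) → Carrier
  Σ[_] {ℕ.zero}  f = 0#
  Σ[_] {ℕ.suc n} f = f Fin.zero + Σ[_] (λ i → f (Fin.suc i))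

  ΣIn : ∀ {n} → Subset n → (Fin n → Carrier) → Carrier
  ΣIn Z f = Σ[ (λ k → if lookup Z k then f k else 0#) ]

  Matrix : ℕ → Set c
  Matrix n = Fin n → Fin n → Carrier

  Vector : ℕ → Set c
  Vector n = Fin n → Carrier

  δ : ∀ {n} → Fin n → Fin n → Carrier
  δ i j = if does (i ≟ᶠ j) then 1# else 0#

  _+diag_ : ∀ {n} → Matrix n → Subset n → Matrix n
  (M +diag Z) i j = if lookup Z i ∧' does (i ≟ᶠ j) then M i j + 1# else M i j
    where
    _∧'_ : Bool → Bool → Bool
    true ∧' b = b
    false ∧' _ = false

  IsInverseOn : ∀ {n} → Matrix n → Subset n → Matrix n → Set ℓ
  IsInverseOn M Z Q =
    (∀ i j → i ∈ Z → j ∈ Z → ΣIn Z (λ k → Q i k * M k j) ≈ δ i j) ×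
    (∀ i j → i ∈ Z → j ∈ Z → ΣIn Z (λ k → M i k * Q k j) ≈ δ i j)

  pivot : ∀ {n} → Matrix n → Subset n → Matrix n → Matrix n
  pivot M Z Q i j with lookup Z i | lookup Z j
  ... | true  | true  = Q i j
  ... | true  | false = - ΣIn Z (λ k → Q i k * M k j)
  ... | false | true  = ΣIn Z (λ k → M i k * Q k j)
  ... | false | false = M i j - ΣIn Z (λ k → M i k * ΣIn Z (λ l → Q k l * M l j))

  -- B is an X × V matrix (rows outside X are ignored) with B[X] = I
  IdentityOn : ∀ {n} → Subset n → Matrix n → Set ℓ
  IdentityOn X B = ∀ x w → x ∈ X → w ∈ X → B x w ≈ δ x w

  R : ∀ {n} → Subset n → Matrix n → (Carrier → Carrier) → Matrix n
  R X B α i j with lookup X i | lookup X j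
  ... | true  | true  = 0#
  ... | true  | false = B i j
  ... | false | true  = α (- B j i)
  ... | false | false = 0#

  NullSpace : ∀ {n} → Matrix n → Vector n → Set ℓ
  NullSpace M v = ∀ i → Σ[ (λ j → M i j * v j) ] ≈ 0#

  Ker : ∀ {n} → Subset n → Matrix n → Vector n → Set ℓ
  Ker X B v = ∀ x → x ∈ X → Σ[ (λ j → B x j * v j) ] ≈ 0#

  Perp : ∀ {n} → (Vector n → Set ℓ) → Vector n → Set (c ⊔ ℓ)
  Perp L v = ∀ u → L u → Σ[ (λ x → u x * v x) ] ≈ 0#

  αImage : ∀ {n} → (Carrier → Carrier) → (Vector n → Set (c ⊔ ℓ)) → Vector n → Set (c ⊔ ℓ)
  αImage α L v = Σ (Vector _) λ u → L u × (∀ x → v x ≈ α (u x))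

  π : ∀ {n} → Subset n → Vector n → Vector n
  π Y v x = if lookup Y x then v x else 0#

module Submission where

-- Write Z = X ─ Y and M = A + (X ∪ Y).  Because B[X] = I, the block M[X]
-- (hence M[Z]) is the identity, so the pivot on Z is the elementary one.
-- For a pivot on an identity block the classical "graph" description of
-- principal pivot transforms reads
--     (M * Z) v = 0   ⇔   M (v off Z) = (v on Z)                   (1)
-- (module PivotAtIdentityBlock).  For our particular M the rows of (1)
-- indexed by X say exactly Bv = 0 (this uses characteristic 2, which also
-- removes the sign in α(−Sᵀ)), and the
-- rows outside X say that α(π_Y v) is the combination Σ_{k∈X} α(π_Y v)_k B_k
-- of the rows of B (module ReflectionMatrix).  Finally, since B[X] = I,
-- being such a combination of the rows of B is the same as being orthogonal
-- to ker B (module RowSpace), and α(π_Y v) ∈ (ker B)^⊥ is a restatement of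
-- π_Y v ∈ α((ker B)^⊥) because α is an involution (module Conjugation).

open import Defs
open import Level using (Level)
open import Data.Nat using (ℕ)
open import Data.Fin using (Fin; zero; suc) renaming (_≟_ to _≟ᶠ_)
open import Data.Fin.Properties using (suc-injective)
open import Data.Bool using (Bool; true; false; if_then_else_; _∧_; _∨_; not)
open import Data.Vec using (lookup; _∷_)
open import Data.Vec.Properties using (lookup-zipWith; []=⇒lookup; lookup⇒[]=)
open import Data.Fin.Subset using (Subset; _∪_; _─_; _∈_)
open import Data.Product using (Σ; _×_; _,_)
open import Data.Empty using (⊥-elim)
open import Relation.Nullary using (Dec; yes; no)
open import Relation.Binary.PropositionalEquality as P using (_≡_; _≢_)
open import Algebra.Morphism.Structures using (module IsRingHomomorphism)
import Algebra.Properties.Ring as RingProperties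
import Algebra.Properties.CommutativeSemigroup as CommutativeSemigroupProperties
import Relation.Binary.Reasoning.Setoid as SetoidReasoning

lookup-∪ : ∀ {n} (p q : Subset n) k → lookup (p ∪ q) k ≡ lookup p k ∨ lookup q k
lookup-∪ p q k = lookup-zipWith _∨_ k p q

lookup-─ : ∀ {n} (p q : Subset n) k → lookup (p ─ q) k ≡ lookup p k ∧ not (lookup q k)
lookup-─ (true  ∷ p) (true  ∷ q) zero    = P.refl
lookup-─ (true  ∷ p) (false ∷ q) zero    = P.refl
lookup-─ (false ∷ p) (true  ∷ q) zero    = P.refl
lookup-─ (false ∷ p) (false ∷ q) zero    = P.refl
lookup-─ (_     ∷ p) (_     ∷ q) (suc k) = lookup-─ p q k

by-cases : ∀ {a} {A : Set a} (b : Bool) → (b ≡ true → A) → (b ≡ false → A) → A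
by-cases true  on-true on-false = on-true P.refl
by-cases false on-true on-false = on-false P.refl

module LinearAlgebra {c ℓ : Level} (F : Field c ℓ) where
  open Field F hiding (zero)
  open RingProperties ring using (-0#≈0#; -‿+-comm)
  open CommutativeSemigroupProperties +-commutativeSemigroup using (interchange)
  open SetoidReasoning setoid

  ∑ : ∀ {m} → (Fin m → Carrier) → Carrier
  ∑ f = Σ[_] F f

  ∑-cong : ∀ {m} {f g : Fin m → Carrier} → (∀ k → f k ≈ g k) → ∑ f ≈ ∑ g
  ∑-cong {ℕ.zero}  f≈g = refl
  ∑-cong {ℕ.suc m} f≈g = +-cong (f≈g zero) (∑-cong (λ k → f≈g (suc k)))

  ∑-zero : ∀ {m} {f : Fin m → Carrier} → (∀ k → f k ≈ 0#) → ∑ f ≈ 0#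
  ∑-zero {ℕ.zero}  f≈0 = refl
  ∑-zero {ℕ.suc m} f≈0 =
    trans (+-cong (f≈0 zero) (∑-zero (λ k → f≈0 (suc k)))) (+-identityˡ 0#)

  ∑-single : ∀ {m} {f : Fin m → Carrier} (p : Fin m) →
             (∀ k → k ≢ p → f k ≈ 0#) → ∑ f ≈ f p
  ∑-single zero    f≈0 =
    trans (+-cong refl (∑-zero (λ k → f≈0 (suc k) (λ ())))) (+-identityʳ _)
  ∑-single (suc p) f≈0 =
    trans (+-cong (f≈0 zero (λ ()))
                  (∑-single p (λ k k≢p → f≈0 (suc k) (λ e → k≢p (suc-injective e)))))
          (+-identityˡ _)

  ∑-+ : ∀ {m} {f g : Fin m → Carrier} → ∑ (λ k → f k + g k) ≈ ∑ f + ∑ g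
  ∑-+ {ℕ.zero}          = sym (+-identityˡ 0#)
  ∑-+ {ℕ.suc m} {f} {g} =
    trans (+-cong refl (∑-+ {m})) (interchange (f zero) (g zero) _ _)

  ∑-neg : ∀ {m} {f : Fin m → Carrier} → ∑ (λ k → - f k) ≈ - ∑ f
  ∑-neg {ℕ.zero}      = sym -0#≈0#
  ∑-neg {ℕ.suc m} {f} = trans (+-cong refl (∑-neg {m})) (-‿+-comm (f zero) _)

  ∑-*ˡ : ∀ {m} (a : Carrier) {f : Fin m → Carrier} → ∑ (λ k → a * f k) ≈ a * ∑ f
  ∑-*ˡ {ℕ.zero}  a = sym (zeroʳ a)
  ∑-*ˡ {ℕ.suc m} a = trans (+-cong refl (∑-*ˡ {m} a)) (sym (distribˡ a _ _))

  ∑-*ʳ : ∀ {m} (a : Carrier) {f : Fin m → Carrier} → ∑ (λ k → f k * a) ≈ ∑ f * a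
  ∑-*ʳ {ℕ.zero}  a = sym (zeroˡ a)
  ∑-*ʳ {ℕ.suc m} a = trans (+-cong refl (∑-*ʳ {m} a)) (sym (distribʳ a _ _))

  ∑-swap : ∀ {m k} (f : Fin m → Fin k → Carrier) →
           ∑ (λ i → ∑ (λ j → f i j)) ≈ ∑ (λ j → ∑ (λ i → f i j))
  ∑-swap {ℕ.zero}  {k} f = sym (∑-zero {k} (λ _ → refl))
  ∑-swap {ℕ.suc m} {k} f =
    trans (+-cong refl (∑-swap {m} {k} (λ i → f (suc i)))) (sym (∑-+ {k}))

  ∑-additive : ∀ {m} (h : Carrier → Carrier) → h 0# ≈ 0# →
               (∀ x y → h (x + y) ≈ h x + h y) →
               (f : Fin m → Carrier) → h (∑ f) ≈ ∑ (λ k → h (f k))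
  ∑-additive {ℕ.zero}  h h0 h+ f = h0
  ∑-additive {ℕ.suc m} h h0 h+ f =
    trans (h+ _ _) (+-cong refl (∑-additive h h0 h+ (λ k → f (suc k))))

  πᶜ : ∀ {m} → Subset m → (Fin m → Carrier) → Fin m → Carrier
  πᶜ W v k = if lookup W k then 0# else v k

  π-in : ∀ {m} (W : Subset m) (v : Fin m → Carrier) {k} → lookup W k ≡ true → π F W v k ≈ v k
  π-in W v k∈W rewrite k∈W = refl

  π-out : ∀ {m} (W : Subset m) (v : Fin m → Carrier) {k} → lookup W k ≡ false → π F W v k ≈ 0#
  π-out W v k∉W rewrite k∉W = refl

  π+πᶜ : ∀ {m} (W : Subset m) (v : Fin m → Carrier) k → v k ≈ π F W v k + πᶜ W v k
  π+πᶜ W v k with lookup W k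
  ... | true  = sym (+-identityʳ _)
  ... | false = sym (+-identityˡ _)

  *-π : ∀ {m} (W : Subset m) (a : Carrier) (v : Fin m → Carrier) k →
        a * π F W v k ≈ (if lookup W k then a * v k else 0#)
  *-π W a v k with lookup W k
  ... | true  = refl
  ... | false = zeroʳ a

  π-* : ∀ {m} (W : Subset m) (v : Fin m → Carrier) (a : Carrier) k →
        π F W v k * a ≈ (if lookup W k then v k * a else 0#)
  π-* W v a k with lookup W k
  ... | true  = refl
  ... | false = zeroˡ a

  δ-diag : ∀ {m} (i : Fin m) → δ F i i ≈ 1#
  δ-diag i with i ≟ᶠ i
  ... | yes _   = refl
  ... | no i≢i = ⊥-elim (i≢i P.refl)

  δ-off : ∀ {m} {i j : Fin m} → i ≢ j → δ F i j ≈ 0#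
  δ-off {i = i} {j} i≢j with i ≟ᶠ j
  ... | yes i≡j = ⊥-elim (i≢j i≡j)
  ... | no _    = refl

  δ-sym : ∀ {m} (i j : Fin m) → δ F i j ≈ δ F j i
  δ-sym i j with i ≟ᶠ j | j ≟ᶠ i
  ... | yes _   | yes _   = refl
  ... | no _    | no _    = refl
  ... | yes i≡j | no j≢i = ⊥-elim (j≢i (P.sym i≡j))
  ... | no i≢j | yes j≡i = ⊥-elim (i≢j (P.sym j≡i))

  ∑-δ : ∀ {m} (p : Fin m) (g : Fin m → Carrier) → ∑ (λ k → δ F k p * g k) ≈ g p
  ∑-δ p g = trans (∑-single p (λ k k≢p → trans (*-cong (δ-off k≢p) refl) (zeroˡ _)))
                  (trans (*-cong (δ-diag p) refl) (*-identityˡ _))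

  ΣIn-cong : ∀ {m} (W : Subset m) {f g : Fin m → Carrier} →
             (∀ k → lookup W k ≡ true → f k ≈ g k) → ΣIn F W f ≈ ΣIn F W g
  ΣIn-cong W {f} {g} f≈g = ∑-cong termwise
    where
    termwise : ∀ k → (if lookup W k then f k else 0#) ≈ (if lookup W k then g k else 0#)
    termwise k with lookup W k in k∈W
    ... | true  = f≈g k k∈W
    ... | false = refl

  ΣIn-zero : ∀ {m} (W : Subset m) {f : Fin m → Carrier} →
             (∀ k → lookup W k ≡ true → f k ≈ 0#) → ΣIn F W f ≈ 0#
  ΣIn-zero W {f} f≈0 = ∑-zero termwise
    where
    termwise : ∀ k → (if lookup W k then f k else 0#) ≈ 0#
    termwise k with lookup W k in k∈W
    ... | true  = f≈0 k k∈W
    ... | false = refl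

  ΣIn-unit : ∀ {m} (W : Subset m) (p : Fin m) {e g : Fin m → Carrier} →
             (∀ k → lookup W k ≡ true → e k ≈ δ F k p) →
             ΣIn F W (λ k → e k * g k) ≈ π F W g p
  ΣIn-unit W p {e} {g} e≈δ = trans (∑-single p off-p) at-p
    where
    off-p : ∀ k → k ≢ p → (if lookup W k then e k * g k else 0#) ≈ 0#
    off-p k k≢p with lookup W k in k∈W
    ... | true  = trans (*-cong (trans (e≈δ k k∈W) (δ-off k≢p)) refl) (zeroˡ _)
    ... | false = refl
    at-p : (if lookup W p then e p * g p else 0#) ≈ π F W g p
    at-p with lookup W p in p∈W
    ... | true  = trans (*-cong (trans (e≈δ p p∈W) (δ-diag p)) refl) (*-identityˡ _)
    ... | false = refl

  ΣIn-unitʳ : ∀ {m} (W : Subset m) (p : Fin m) {e g : Fin m → Carrier} →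
              (∀ k → lookup W k ≡ true → e k ≈ δ F k p) →
              ΣIn F W (λ k → g k * e k) ≈ π F W g p
  ΣIn-unitʳ W p e≈δ = trans (ΣIn-cong W (λ k _ → *-comm _ _)) (ΣIn-unit W p e≈δ)

  ΣIn-∑-assoc : ∀ {m} (W : Subset m) (a : Fin m → Carrier)
                (N : Fin m → Fin m → Carrier) (x : Fin m → Carrier) →
                ∑ (λ j → ΣIn F W (λ k → a k * N k j) * x j) ≈
                ΣIn F W (λ k → a k * ∑ (λ j → N k j * x j))
  ΣIn-∑-assoc {m} W a N x = begin
    ∑ (λ j → ΣIn F W (λ k → a k * N k j) * x j)
      ≈⟨ ∑-cong {m} (λ j → ∑-*ʳ {m} (x j)) ⟨
    ∑ (λ j → ∑ (λ k → (if lookup W k then a k * N k j else 0#) * x j))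
      ≈⟨ ∑-swap {m} {m} _ ⟩
    ∑ (λ k → ∑ (λ j → (if lookup W k then a k * N k j else 0#) * x j))
      ≈⟨ ∑-cong {m} inner ⟩
    ΣIn F W (λ k → a k * ∑ (λ j → N k j * x j)) ∎
    where
    inner : ∀ k → ∑ (λ j → (if lookup W k then a k * N k j else 0#) * x j) ≈
                  (if lookup W k then a k * ∑ (λ j → N k j * x j) else 0#)
    inner k with lookup W k
    ... | true  = trans (∑-cong {m} (λ j → *-assoc _ _ _)) (∑-*ˡ {m} (a k))
    ... | false = ∑-zero {m} (λ j → zeroˡ (x j))

  +diag-off : ∀ {m} (N : Matrix F m) (W : Subset m) {i j} → i ≢ j → _+diag_ F N W i j ≈ N i j
  +diag-off N W {i} {j} i≢j with lookup W i | i ≟ᶠ j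
  ... | false | _       = refl
  ... | true  | no _    = refl
  ... | true  | yes i≡j = ⊥-elim (i≢j i≡j)

  +diag-on : ∀ {m} (N : Matrix F m) (W : Subset m) {i} → lookup W i ≡ true →
             _+diag_ F N W i i ≈ N i i + 1#
  +diag-on N W {i} i∈W rewrite i∈W with i ≟ᶠ i
  ... | yes _   = refl
  ... | no i≢i = ⊥-elim (i≢i P.refl)

  +diag-out : ∀ {m} (N : Matrix F m) (W : Subset m) {i} j → lookup W i ≡ false →
              _+diag_ F N W i j ≈ N i j
  +diag-out N W j i∉W rewrite i∉W = refl

module PivotAtIdentityBlock {c ℓ : Level} (F : Field c ℓ) {n : ℕ}
  (M : Matrix F n) (Z : Subset n)
  (M[Z]≈I : ∀ i j → lookup Z i ≡ true → lookup Z j ≡ true → Field._≈_ F (M i j) (δ F i j))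
  where
  open Field F hiding (zero)
  open RingProperties ring using (-0#≈0#; -‿distribˡ-*; [y-z]x≈yx-zx; x∙y⁻¹≈ε⇒x≈y; x≈y⇒x∙y⁻¹≈ε; xyx⁻¹≈y)
  open LinearAlgebra F
  open SetoidReasoning setoid

  identity-inverts : IsInverseOn F M Z (δ F)
  identity-inverts = left , right
    where
    left : ∀ i j → i ∈ Z → j ∈ Z → ΣIn F Z (λ k → δ F i k * M k j) ≈ δ F i j
    left i j i∈Z j∈Z =
      trans (ΣIn-unit Z i (λ k _ → δ-sym i k))
            (trans (π-in Z (λ k → M k j) ([]=⇒lookup i∈Z)) (M[Z]≈I i j ([]=⇒lookup i∈Z) ([]=⇒lookup j∈Z)))
    right : ∀ i j → i ∈ Z → j ∈ Z → ΣIn F Z (λ k → M i k * δ F k j) ≈ δ F i j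
    right i j i∈Z j∈Z =
      trans (ΣIn-unitʳ Z j (λ k _ → refl))
            (trans (π-in Z (M i) ([]=⇒lookup j∈Z)) (M[Z]≈I i j ([]=⇒lookup i∈Z) ([]=⇒lookup j∈Z)))

  -- Conversely any left inverse Q of M[Z] is the identity, as Q = Q · M[Z].
  inverse-is-identity : ∀ {Q} → IsInverseOn F M Z Q →
    ∀ i j → lookup Z i ≡ true → lookup Z j ≡ true → Q i j ≈ δ F i j
  inverse-is-identity {Q} (QM≈I , _) i j i∈Z j∈Z = begin
    Q i j                          ≈⟨ π-in Z (Q i) j∈Z ⟨
    π F Z (Q i) j                  ≈⟨ ΣIn-unitʳ Z j (λ k k∈Z → M[Z]≈I k j k∈Z j∈Z) ⟨
    ΣIn F Z (λ k → Q i k * M k j)  ≈⟨ QM≈I i j (lookup⇒[]= i Z i∈Z) (lookup⇒[]= j Z j∈Z) ⟩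
    δ F i j                        ∎

  M·off : Vector F n → Fin n → Carrier
  M·off v i = ∑ (λ j → M i j * πᶜ Z v j)

  Graph : Vector F n → Set ℓ
  Graph v = ∀ i → M·off v i ≈ π F Z v i

  module _ {Q : Matrix F n} (Q-inverse : IsInverseOn F M Z Q) where

    Q≈I : ∀ i j → lookup Z i ≡ true → lookup Z j ≡ true → Q i j ≈ δ F i j
    Q≈I = inverse-is-identity Q-inverse

    pivot-row-in : ∀ v {i} → lookup Z i ≡ true →
      ∑ (λ j → pivot F M Z Q i j * v j) ≈ v i - M·off v i
    pivot-row-in v {i} i∈Z = begin
      ∑ (λ j → pivot F M Z Q i j * v j)
        ≈⟨ ∑-cong {n} termwise ⟩
      ∑ (λ j → (if lookup Z j then δ F j i * v j else 0#) + - (M i j * πᶜ Z v j))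
        ≈⟨ ∑-+ {n} ⟩
      ΣIn F Z (λ j → δ F j i * v j) + ∑ (λ j → - (M i j * πᶜ Z v j))
        ≈⟨ +-cong (trans (ΣIn-unit Z i (λ _ _ → refl)) (π-in Z v i∈Z)) (∑-neg {n}) ⟩
      v i - M·off v i ∎
      where
      Q-row : ∀ j → ΣIn F Z (λ k → Q i k * M k j) ≈ M i j
      Q-row j = trans (ΣIn-unit Z i (λ k k∈Z → trans (Q≈I i k i∈Z k∈Z) (δ-sym i k)))
                      (π-in Z (λ k → M k j) i∈Z)
      termwise : ∀ j → pivot F M Z Q i j * v j ≈
                       (if lookup Z j then δ F j i * v j else 0#) + - (M i j * πᶜ Z v j)
      termwise j rewrite i∈Z with lookup Z j in j∈Z
      ... | true  = trans (*-cong (trans (Q≈I i j i∈Z j∈Z) (δ-sym i j)) refl)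
                          (sym (trans (+-cong refl (trans (-‿cong (zeroʳ _)) -0#≈0#)) (+-identityʳ _)))
      ... | false = trans (*-cong (-‿cong (Q-row j)) refl)
                          (trans (sym (-‿distribˡ-* _ _)) (sym (+-identityˡ _)))

    pivot-row-out : ∀ v {i} → lookup Z i ≡ false →
      ∑ (λ j → pivot F M Z Q i j * v j) ≈
      (ΣIn F Z (λ k → M i k * v k) + M·off v i) - ΣIn F Z (λ k → M i k * M·off v k)
    pivot-row-out v {i} i∉Z = begin
      ∑ (λ j → pivot F M Z Q i j * v j)
        ≈⟨ ∑-cong {n} termwise ⟩
      ∑ (λ j → ((if lookup Z j then M i j * v j else 0#) + M i j * πᶜ Z v j) - S j * πᶜ Z v j)
        ≈⟨ ∑-+ {n} ⟩
      ∑ (λ j → (if lookup Z j then M i j * v j else 0#) + M i j * πᶜ Z v j) +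
        ∑ (λ j → - (S j * πᶜ Z v j))
        ≈⟨ +-cong (∑-+ {n}) (∑-neg {n}) ⟩
      (ΣIn F Z (λ k → M i k * v k) + M·off v i) - ∑ (λ j → S j * πᶜ Z v j)
        ≈⟨ +-cong refl (-‿cong (ΣIn-∑-assoc Z (M i) M (πᶜ Z v))) ⟩
      (ΣIn F Z (λ k → M i k * v k) + M·off v i) - ΣIn F Z (λ k → M i k * M·off v k) ∎
      where
      S : Fin n → Carrier
      S j = ΣIn F Z (λ k → M i k * M k j)
      termwise : ∀ j → pivot F M Z Q i j * v j ≈
        ((if lookup Z j then M i j * v j else 0#) + M i j * πᶜ Z v j) - S j * πᶜ Z v j
      termwise j rewrite i∉Z with lookup Z j in j∈Z
      ... | true  =
        trans (*-cong (trans (ΣIn-unitʳ Z j (λ k k∈Z → Q≈I k j k∈Z j∈Z)) (π-in Z (M i) j∈Z)) refl)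
              (sym (trans (+-cong (trans (+-cong refl (zeroʳ _)) (+-identityʳ _))
                                  (trans (-‿cong (zeroʳ _)) -0#≈0#))
                          (+-identityʳ _)))
      ... | false =
        trans (*-cong (+-cong refl (-‿cong (ΣIn-cong Z (λ k k∈Z → *-cong refl
                (trans (ΣIn-unit Z k (λ l l∈Z → trans (Q≈I k l k∈Z l∈Z) (δ-sym k l)))
                       (π-in Z (λ l → M l j) k∈Z)))))) refl)
              (trans ([y-z]x≈yx-zx _ _ _) (+-cong (sym (+-identityˡ _)) refl))

    null⇒graph : ∀ v → NullSpace F (pivot F M Z Q) v → Graph v
    null⇒graph v Cv≈0 i = by-cases (lookup Z i)
      (λ i∈Z → trans (on-Z i∈Z) (sym (π-in Z v i∈Z)))
      (λ i∉Z → trans (off-Z i∉Z) (sym (π-out Z v i∉Z)))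
      where
      on-Z : ∀ {k} → lookup Z k ≡ true → M·off v k ≈ v k
      on-Z k∈Z = sym (x∙y⁻¹≈ε⇒x≈y _ _ (trans (sym (pivot-row-in v k∈Z)) (Cv≈0 _)))
      off-Z : lookup Z i ≡ false → M·off v i ≈ 0#
      off-Z i∉Z = begin
        M·off v i
          ≈⟨ xyx⁻¹≈y (ΣIn F Z (λ k → M i k * v k)) _ ⟨
        (ΣIn F Z (λ k → M i k * v k) + M·off v i) - ΣIn F Z (λ k → M i k * v k)
          ≈⟨ +-cong refl (-‿cong (ΣIn-cong Z (λ k k∈Z → *-cong refl (sym (on-Z k∈Z))))) ⟩
        (ΣIn F Z (λ k → M i k * v k) + M·off v i) - ΣIn F Z (λ k → M i k * M·off v k)
          ≈⟨ pivot-row-out v i∉Z ⟨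
        ∑ (λ j → pivot F M Z Q i j * v j)
          ≈⟨ Cv≈0 i ⟩
        0# ∎

    graph⇒null : ∀ v → Graph v → NullSpace F (pivot F M Z Q) v
    graph⇒null v graph i = by-cases (lookup Z i)
      (λ i∈Z → trans (pivot-row-in v i∈Z)
                     (x≈y⇒x∙y⁻¹≈ε (sym (trans (graph i) (π-in Z v i∈Z)))))
      (λ i∉Z → begin
        ∑ (λ j → pivot F M Z Q i j * v j)
          ≈⟨ pivot-row-out v i∉Z ⟩
        (ΣIn F Z (λ k → M i k * v k) + M·off v i) - ΣIn F Z (λ k → M i k * M·off v k)
          ≈⟨ +-cong refl (-‿cong (ΣIn-cong Z (λ k k∈Z →
               *-cong refl (trans (graph k) (π-in Z v k∈Z))))) ⟩
        (ΣIn F Z (λ k → M i k * v k) + M·off v i) - ΣIn F Z (λ k → M i k * v k)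
          ≈⟨ xyx⁻¹≈y _ _ ⟩
        M·off v i
          ≈⟨ trans (graph i) (π-out Z v i∉Z) ⟩
        0# ∎)

module Characteristic2 {c ℓ : Level} (F : Field c ℓ) (char2 : Char2 F) where
  open Field F hiding (zero)
  open RingProperties ring using (+-inverseˡ-unique)
  open SetoidReasoning setoid

  x+x≈0 : ∀ x → x + x ≈ 0#
  x+x≈0 x = begin
    x + x            ≈⟨ +-cong (*-identityˡ x) (*-identityˡ x) ⟨
    1# * x + 1# * x  ≈⟨ distribʳ x 1# 1# ⟨
    (1# + 1#) * x    ≈⟨ *-cong char2 refl ⟩
    0# * x           ≈⟨ zeroˡ x ⟩
    0#               ∎

  -x≈x : ∀ x → - x ≈ x
  -x≈x x = sym (+-inverseˡ-unique x x (x+x≈0 x))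

  sum≈0⇒≈ : ∀ {x y} → x + y ≈ 0# → x ≈ y
  sum≈0⇒≈ {x} {y} x+y≈0 = trans (+-inverseˡ-unique x y x+y≈0) (-x≈x y)

  ≈⇒sum≈0 : ∀ {x y} → x ≈ y → x + y ≈ 0#
  ≈⇒sum≈0 {y = y} x≈y = trans (+-cong x≈y refl) (x+x≈0 y)

module Conjugation {c ℓ : Level} (F : Field c ℓ) (α : Field.Carrier F → Field.Carrier F)
  (α-involution : InvolutiveAutomorphism F α) where
  open Field F hiding (zero)
  open LinearAlgebra F
  open InvolutiveAutomorphism α-involution
  open IsRingHomomorphism isRingHom using (⟦⟧-cong; +-homo; *-homo; 0#-homo)
  open SetoidReasoning setoid

  α-ΣIn : ∀ {m} (W : Subset m) (f : Fin m → Carrier) →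
          α (ΣIn F W f) ≈ ΣIn F W (λ k → α (f k))
  α-ΣIn {m} W f = trans (∑-additive {m} α 0#-homo +-homo _) (∑-cong {m} termwise)
    where
    termwise : ∀ k → α (if lookup W k then f k else 0#) ≈ (if lookup W k then α (f k) else 0#)
    termwise k with lookup W k
    ... | true  = refl
    ... | false = 0#-homo

  conjugate-relation : ∀ {m} (W : Subset m) (b w : Fin m → Carrier) {x} →
    x ≈ ΣIn F W (λ k → α (b k) * w k) → α x ≈ ΣIn F W (λ k → b k * α (w k))
  conjugate-relation W b w {x} x≈ = begin
    α x                                ≈⟨ ⟦⟧-cong x≈ ⟩
    α (ΣIn F W (λ k → α (b k) * w k))  ≈⟨ α-ΣIn W _ ⟩
    ΣIn F W (λ k → α (α (b k) * w k))  ≈⟨ ΣIn-cong W (λ k _ →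
                                            trans (*-homo _ _) (*-cong (involutive (b k)) refl)) ⟩
    ΣIn F W (λ k → b k * α (w k))      ∎

  conjugate-relation⁻¹ : ∀ {m} (W : Subset m) (b w : Fin m → Carrier) {x} →
    α x ≈ ΣIn F W (λ k → b k * α (w k)) → x ≈ ΣIn F W (λ k → α (b k) * w k)
  conjugate-relation⁻¹ W b w {x} αx≈ = begin
    x                                  ≈⟨ involutive x ⟨
    α (α x)                            ≈⟨ ⟦⟧-cong αx≈ ⟩
    α (ΣIn F W (λ k → b k * α (w k)))  ≈⟨ α-ΣIn W _ ⟩
    ΣIn F W (λ k → α (b k * α (w k)))  ≈⟨ ΣIn-cong W (λ k _ →
                                            trans (*-homo _ _) (*-cong refl (involutive (w k)))) ⟩
    ΣIn F W (λ k → α (b k) * w k)      ∎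

  perp-of-conjugate : ∀ {m} (L : Vector F m → Set ℓ) (w : Vector F m) →
    Perp F L (λ k → α (w k)) → αImage F α (Perp F L) w
  perp-of-conjugate L w α[w]⊥L = (λ k → α (w k)) , α[w]⊥L , λ k → sym (involutive (w k))

  conjugate-of-perp : ∀ {m} (L : Vector F m → Set ℓ) (w : Vector F m) →
    αImage F α (Perp F L) w → Perp F L (λ k → α (w k))
  conjugate-of-perp {m} L w (u , u⊥L , w≈αu) z z∈L =
    trans (∑-cong {m} (λ k → *-cong refl (trans (⟦⟧-cong (w≈αu k)) (involutive (u k)))))
          (u⊥L z z∈L)

module RowSpace {c ℓ : Level} (F : Field c ℓ) {n : ℕ} (X : Subset n) (B : Matrix F n)
  (B[X]≈I : IdentityOn F X B) where
  open Field F hiding (zero)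
  open RingProperties ring using (x[y-z]≈xy-xz; [y-z]x≈yx-zx; x∙y⁻¹≈ε⇒x≈y)
  open LinearAlgebra F
  open SetoidReasoning setoid

  B-unit : ∀ {x k} → lookup X x ≡ true → lookup X k ≡ true → B x k ≈ δ F x k
  B-unit x∈X k∈X = B[X]≈I _ _ (lookup⇒[]= _ X x∈X) (lookup⇒[]= _ X k∈X)

  -- u = Σ_{k∈X} u_k B_k; the coefficients are forced to be u_k since B[X] = I.
  InRowSpace : Vector F n → Set ℓ
  InRowSpace u = ∀ i → u i ≈ ΣIn F X (λ k → B k i * u k)

  row-combination-on-X : ∀ u {i} → lookup X i ≡ true → ΣIn F X (λ k → B k i * u k) ≈ u i
  row-combination-on-X u i∈X = trans (ΣIn-unit X _ (λ k k∈X → B-unit k∈X i∈X)) (π-in X u i∈X)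

  kernel-vector : Fin n → Vector F n
  kernel-vector i k = δ F k i - π F X (λ l → B l i) k

  kernel-vector∈Ker : ∀ i → Ker F X B (kernel-vector i)
  kernel-vector∈Ker i x x∈X = begin
    ∑ (λ k → B x k * (δ F k i - π F X (λ l → B l i) k))
      ≈⟨ ∑-cong {n} (λ k → x[y-z]≈xy-xz _ _ _) ⟩
    ∑ (λ k → B x k * δ F k i - B x k * π F X (λ l → B l i) k)
      ≈⟨ ∑-+ {n} ⟩
    ∑ (λ k → B x k * δ F k i) + ∑ (λ k → - (B x k * π F X (λ l → B l i) k))
      ≈⟨ +-cong unit-part (trans (∑-neg {n}) (-‿cong X-part)) ⟩
    B x i - B x i
      ≈⟨ -‿inverseʳ _ ⟩
    0# ∎
    where
    unit-part : ∑ (λ k → B x k * δ F k i) ≈ B x i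
    unit-part = trans (∑-cong {n} (λ k → *-comm _ _)) (∑-δ i (B x))
    X-part : ∑ (λ k → B x k * π F X (λ l → B l i) k) ≈ B x i
    X-part = trans (∑-cong {n} (λ k → *-π X (B x k) (λ l → B l i) k))
      (trans (ΣIn-unit X x (λ k k∈X → trans (B-unit ([]=⇒lookup x∈X) k∈X) (δ-sym x k)))
             (π-in X (λ l → B l i) ([]=⇒lookup x∈X)))

  perp⇒row-space : ∀ u → Perp F (Ker F X B) u → InRowSpace u
  perp⇒row-space u u⊥ i = x∙y⁻¹≈ε⇒x≈y _ _ (trans (sym pairing) (u⊥ _ (kernel-vector∈Ker i)))
    where
    pairing : ∑ (λ k → kernel-vector i k * u k) ≈ u i - ΣIn F X (λ k → B k i * u k)
    pairing = begin
      ∑ (λ k → kernel-vector i k * u k)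
        ≈⟨ ∑-cong {n} (λ k → [y-z]x≈yx-zx _ _ _) ⟩
      ∑ (λ k → δ F k i * u k - π F X (λ l → B l i) k * u k)
        ≈⟨ ∑-+ {n} ⟩
      ∑ (λ k → δ F k i * u k) + ∑ (λ k → - (π F X (λ l → B l i) k * u k))
        ≈⟨ +-cong (∑-δ i u) (trans (∑-neg {n})
             (-‿cong (∑-cong {n} (λ k → π-* X (λ l → B l i) (u k) k)))) ⟩
      u i - ΣIn F X (λ k → B k i * u k) ∎

  row-space⇒perp : ∀ u → InRowSpace u → Perp F (Ker F X B) u
  row-space⇒perp u u∈rows z Bz≈0 = begin
    ∑ (λ k → z k * u k)
      ≈⟨ ∑-cong {n} (λ k → trans (*-comm _ _)
           (*-cong (trans (u∈rows k) (ΣIn-cong X (λ l _ → *-comm _ _))) refl)) ⟩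
    ∑ (λ k → ΣIn F X (λ l → u l * B l k) * z k)
      ≈⟨ ΣIn-∑-assoc X u B z ⟩
    ΣIn F X (λ l → u l * ∑ (λ k → B l k * z k))
      ≈⟨ ΣIn-zero X (λ l l∈X → trans (*-cong refl (Bz≈0 l (lookup⇒[]= l X l∈X))) (zeroʳ _)) ⟩
    0# ∎

module ReflectionMatrix {c ℓ : Level} (F : Field c ℓ) (char2 : Char2 F)
  (α : Field.Carrier F → Field.Carrier F) (α-involution : InvolutiveAutomorphism F α)
  {n : ℕ} (X Y : Subset n) (B : Matrix F n) (B[X]≈I : IdentityOn F X B) where
  open Field F hiding (zero)
  open LinearAlgebra F
  open Characteristic2 F char2
  open Conjugation F α α-involution using (conjugate-relation; conjugate-relation⁻¹)
  open RowSpace F X B B[X]≈I using (B-unit; InRowSpace; row-combination-on-X)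
  open IsRingHomomorphism (InvolutiveAutomorphism.isRingHom α-involution) using (⟦⟧-cong)
  open SetoidReasoning setoid

  M : Matrix F n
  M = _+diag_ F (R F X B α) (X ∪ Y)

  Z : Subset n
  Z = X ─ Y

  ∪-on-X : ∀ {k} → lookup X k ≡ true → lookup (X ∪ Y) k ≡ true
  ∪-on-X {k} k∈X rewrite lookup-∪ X Y k | k∈X = P.refl

  ∪-off-X : ∀ {k} → lookup X k ≡ false → lookup (X ∪ Y) k ≡ lookup Y k
  ∪-off-X {k} k∉X rewrite lookup-∪ X Y k | k∉X = P.refl

  Z-on-X : ∀ {k} → lookup X k ≡ true → lookup Z k ≡ not (lookup Y k)
  Z-on-X {k} k∈X rewrite lookup-─ X Y k | k∈X = P.refl

  Z-off-X : ∀ {k} → lookup X k ≡ false → lookup Z k ≡ false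
  Z-off-X {k} k∉X rewrite lookup-─ X Y k | k∉X = P.refl

  Z⊆X : ∀ {k} → lookup Z k ≡ true → lookup X k ≡ true
  Z⊆X {k} k∈Z = by-cases (lookup X k) (λ k∈X → k∈X)
    (λ k∉X → ⊥-elim (false≢true (P.trans (P.sym (Z-off-X k∉X)) k∈Z)))
    where
    false≢true : false ≢ true
    false≢true ()

  πᶜZ-on-X : ∀ v {k} → lookup X k ≡ true → πᶜ Z v k ≡ π F Y v k
  πᶜZ-on-X v {k} k∈X rewrite Z-on-X k∈X with lookup Y k
  ... | true  = P.refl
  ... | false = P.refl

  πᶜZ-off-X : ∀ v {k} → lookup X k ≡ false → πᶜ Z v k ≡ v k
  πᶜZ-off-X v k∉X rewrite Z-off-X k∉X = P.refl

  R-on-on : ∀ {i j} → lookup X i ≡ true → lookup X j ≡ true → R F X B α i j ≈ 0#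
  R-on-on i∈X j∈X rewrite i∈X | j∈X = refl

  R-on-off : ∀ {i j} → lookup X i ≡ true → lookup X j ≡ false → R F X B α i j ≈ B i j
  R-on-off i∈X j∉X rewrite i∈X | j∉X = refl

  -- Characteristic 2 removes the sign of α(−Sᵀ).
  R-off-on : ∀ {i j} → lookup X i ≡ false → lookup X j ≡ true → R F X B α i j ≈ α (B j i)
  R-off-on {i} {j} i∉X j∈X rewrite i∉X | j∈X = ⟦⟧-cong (-x≈x (B j i))

  R-off-off : ∀ {i j} → lookup X i ≡ false → lookup X j ≡ false → R F X B α i j ≈ 0#
  R-off-off i∉X j∉X rewrite i∉X | j∉X = refl

  M-row-X : ∀ {i} → lookup X i ≡ true → ∀ j → M i j ≈ B i j
  M-row-X {i} i∈X j = entry (i ≟ᶠ j)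
    where
    entry : Dec (i ≡ j) → M i j ≈ B i j
    entry (yes P.refl) = begin
      M i i               ≈⟨ +diag-on (R F X B α) (X ∪ Y) (∪-on-X i∈X) ⟩
      R F X B α i i + 1#  ≈⟨ +-cong (R-on-on i∈X i∈X) refl ⟩
      0# + 1#             ≈⟨ +-identityˡ 1# ⟩
      1#                  ≈⟨ δ-diag i ⟨
      δ F i i             ≈⟨ B-unit i∈X i∈X ⟨
      B i i               ∎
    entry (no i≢j) = trans (+diag-off (R F X B α) (X ∪ Y) i≢j) (by-cases (lookup X j)
      (λ j∈X → trans (R-on-on i∈X j∈X) (sym (trans (B-unit i∈X j∈X) (δ-off i≢j))))
      (λ j∉X → R-on-off i∈X j∉X))

  M[Z]≈I : ∀ i j → lookup Z i ≡ true → lookup Z j ≡ true → M i j ≈ δ F i j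
  M[Z]≈I i j i∈Z j∈Z = trans (M-row-X (Z⊆X i∈Z) j) (B-unit (Z⊆X i∈Z) (Z⊆X j∈Z))

  open PivotAtIdentityBlock F M Z M[Z]≈I using (M·off; Graph)

  B-row-split : ∀ v {x} → lookup X x ≡ true → ∑ (λ j → B x j * v j) ≈ π F Z v x + M·off v x
  B-row-split v {x} x∈X = begin
    ∑ (λ j → B x j * v j)
      ≈⟨ ∑-cong {n} (λ j → trans (*-cong refl (π+πᶜ Z v j)) (distribˡ _ _ _)) ⟩
    ∑ (λ j → B x j * π F Z v j + B x j * πᶜ Z v j)
      ≈⟨ ∑-+ {n} ⟩
    ∑ (λ j → B x j * π F Z v j) + ∑ (λ j → B x j * πᶜ Z v j)
      ≈⟨ +-cong on-Z (∑-cong {n} (λ j → *-cong (sym (M-row-X x∈X j)) refl)) ⟩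
    π F Z v x + M·off v x ∎
    where
    on-Z : ∑ (λ j → B x j * π F Z v j) ≈ π F Z v x
    on-Z = trans (∑-cong {n} (λ j → *-π Z (B x j) v j))
                 (ΣIn-unit Z x (λ k k∈Z → trans (B-unit x∈X (Z⊆X k∈Z)) (δ-sym x k)))

  M-diagonal-off-X : ∀ v {i} → lookup X i ≡ false → M i i * v i ≈ π F Y v i
  M-diagonal-off-X v {i} i∉X = by-cases (lookup Y i)
    (λ i∈Y → trans (*-cong (trans (+diag-on (R F X B α) (X ∪ Y) (P.trans (∪-off-X i∉X) i∈Y))
                                  (trans (+-cong (R-off-off i∉X i∉X) refl) (+-identityˡ 1#))) refl)
                   (trans (*-identityˡ _) (sym (π-in Y v i∈Y))))
    (λ i∉Y → trans (*-cong (trans (+diag-out (R F X B α) (X ∪ Y) i (P.trans (∪-off-X i∉X) i∉Y))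
                                  (R-off-off i∉X i∉X)) refl)
                   (trans (zeroˡ _) (sym (π-out Y v i∉Y))))

  M-row-off-X : ∀ v {i} → lookup X i ≡ false →
    M·off v i ≈ ΣIn F X (λ k → α (B k i) * π F Y v k) + π F Y v i
  M-row-off-X v {i} i∉X =
    trans (∑-cong {n} termwise) (trans (∑-+ {n}) (+-cong refl (∑-δ i (π F Y v))))
    where
    termwise : ∀ j → M i j * πᶜ Z v j ≈
                     π F X (λ k → α (B k i) * π F Y v k) j + δ F j i * π F Y v j
    termwise j = entry (i ≟ᶠ j)
      where
      entry : Dec (i ≡ j) → M i j * πᶜ Z v j ≈
                            π F X (λ k → α (B k i) * π F Y v k) j + δ F j i * π F Y v j
      entry (yes P.refl) = begin
        M i i * πᶜ Z v i
          ≈⟨ *-cong refl (reflexive (πᶜZ-off-X v i∉X)) ⟩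
        M i i * v i
          ≈⟨ M-diagonal-off-X v i∉X ⟩
        π F Y v i
          ≈⟨ trans (+-identityˡ _) (trans (*-cong (δ-diag i) refl) (*-identityˡ _)) ⟨
        0# + δ F i i * π F Y v i
          ≈⟨ +-cong (π-out X (λ k → α (B k i) * π F Y v k) i∉X) refl ⟨
        π F X (λ k → α (B k i) * π F Y v k) i + δ F i i * π F Y v i ∎
      entry (no i≢j) = trans (*-cong (+diag-off (R F X B α) (X ∪ Y) i≢j) refl)
        (trans off-diagonal
          (sym (trans (+-cong refl (trans (*-cong (δ-off (λ j≡i → i≢j (P.sym j≡i))) refl) (zeroˡ _)))
                      (+-identityʳ _))))
        where
        off-diagonal : R F X B α i j * πᶜ Z v j ≈ π F X (λ k → α (B k i) * π F Y v k) j
        off-diagonal = by-cases (lookup X j)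
          (λ j∈X → trans (*-cong (R-off-on i∉X j∈X) (reflexive (πᶜZ-on-X v j∈X)))
                         (sym (π-in X (λ k → α (B k i) * π F Y v k) j∈X)))
          (λ j∉X → trans (*-cong (R-off-off i∉X j∉X) refl)
                         (trans (zeroˡ _) (sym (π-out X (λ k → α (B k i) * π F Y v k) j∉X))))

  graph⇒kernel×row-space : ∀ v → Graph v → Ker F X B v × InRowSpace (λ k → α (π F Y v k))
  graph⇒kernel×row-space v graph = kernel , row-space
    where
    kernel : Ker F X B v
    kernel x x∈X = trans (B-row-split v ([]=⇒lookup x∈X)) (≈⇒sum≈0 (sym (graph x)))
    row-space : InRowSpace (λ k → α (π F Y v k))
    row-space i = by-cases (lookup X i)
      (λ i∈X → sym (row-combination-on-X _ i∈X))
      (λ i∉X → conjugate-relation X (λ k → B k i) (π F Y v) (sym (sum≈0⇒≈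
        (trans (sym (M-row-off-X v i∉X)) (trans (graph i) (π-out Z v (Z-off-X i∉X)))))))

  kernel×row-space⇒graph : ∀ v → Ker F X B v × InRowSpace (λ k → α (π F Y v k)) → Graph v
  kernel×row-space⇒graph v (Bv≈0 , row-space) i = by-cases (lookup X i)
    (λ i∈X → sym (sum≈0⇒≈ (trans (sym (B-row-split v i∈X)) (Bv≈0 i (lookup⇒[]= i X i∈X)))))
    (λ i∉X → trans (M-row-off-X v i∉X)
      (trans (≈⇒sum≈0 (sym (conjugate-relation⁻¹ X (λ k → B k i) (π F Y v) (row-space i))))
             (sym (π-out Z v (Z-off-X i∉X)))))

lemma3 : {c ℓ : Level} (F : Field c ℓ) → Char2 F →
    (α : Field.Carrier F → Field.Carrier F) → InvolutiveAutomorphism F α →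
    (n : ℕ) (X : Subset n) (B : Matrix F n) → IdentityOn F X B →
    (Y : Subset n) →
      Σ (Matrix F n) (λ Q → IsInverseOn F (_+diag_ F (R F X B α) (X ∪ Y)) (X ─ Y) Q) ×
      (∀ Q → IsInverseOn F (_+diag_ F (R F X B α) (X ∪ Y)) (X ─ Y) Q →
        ∀ v →
          (NullSpace F (pivot F (_+diag_ F (R F X B α) (X ∪ Y)) (X ─ Y) Q) v →
             Ker F X B v × αImage F α (Perp F (Ker F X B)) (π F Y v)) ×
          (Ker F X B v × αImage F α (Perp F (Ker F X B)) (π F Y v) →
             NullSpace F (pivot F (_+diag_ F (R F X B α) (X ∪ Y)) (X ─ Y) Q) v))
lemma3 F char2 α α-involution n X B B[X]≈I Y =
  (δ F , identity-inverts) , λ Q Q-inverse v → forward Q-inverse v , backward Q-inverse v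
  where
  open ReflectionMatrix F char2 α α-involution X Y B B[X]≈I
  open PivotAtIdentityBlock F M Z M[Z]≈I
  open RowSpace F X B B[X]≈I using (perp⇒row-space; row-space⇒perp)
  open Conjugation F α α-involution using (perp-of-conjugate; conjugate-of-perp)

  forward : ∀ {Q} → IsInverseOn F M Z Q → ∀ v → NullSpace F (pivot F M Z Q) v →
            Ker F X B v × αImage F α (Perp F (Ker F X B)) (π F Y v)
  forward Q-inverse v null with graph⇒kernel×row-space v (null⇒graph Q-inverse v null)
  ... | Bv≈0 , row-space =
    Bv≈0 , perp-of-conjugate (Ker F X B) (π F Y v) (row-space⇒perp _ row-space)

  backward : ∀ {Q} → IsInverseOn F M Z Q → ∀ v →
             Ker F X B v × αImage F α (Perp F (Ker F X B)) (π F Y v) →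
             NullSpace F (pivot F M Z Q) v
  backward Q-inverse v (Bv≈0 , image) = graph⇒null Q-inverse v (kernel×row-space⇒graph v
    (Bv≈0 , perp⇒row-space _ (conjugate-of-perp (Ker F X B) (π F Y v) image)))
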